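{- Let $M=(m_{i,j})$ be an $n\times n$ optimal binary matrix. Consider the following rule: if for some $j$ with $1\le j\le n-1$ there are $i_1,i_2$ with $m_{i_1,j}=1$, $m_{i_1,j+1}=0$, $m_{i_2,j}=0$, $m_{i_2,j+1}=1$ and $S_{i_1,j}=S_{i_2,j}$ (where $S_{i,j}=\sum_{l=1}^{j}m_{i,l}$), replace rows $R_{i_1},R_{i_2}$ of the matrix by $R'_{i_1}=(m_{i_1,1},\dots,m_{i_1,j},m_{i_2,j+1},\dots,m_{i_2,n})$ and $R'_{i_2}=(m_{i_2,1},\dots,m_{i_2,j},m_{i_1,j+1},\dots,m_{i_1,n})$. Then by repeated (finitely many) applications of this rule one obtains an optimal matrix $M'$ to which the rule can no longer be applied, i.e. for which there is no $j$ and no such pair $i_1,i_2$ (the scheme $S(M')$ is free of unnecessary bicycle handovers).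
   Context: Biker–hiker model: $n$ travellers $t_1,\dots,t_n$; posts $P_0,\dots,P_n$ at unit spacing; stage $s_j$ is the leg from $P_{j-1}$ to $P_j$. All start at $P_0$ at time $0$, walk at common speed $w$, cycle at common speed $v>w$, mode changes take no time. The $n\times n$ binary matrix $M=(m_{i,j})$ prescribes that $t_i$ cycles $s_j$ iff $m_{i,j}=1$. $M$ is $k$-uniform if every row and every column has exactly $k$ ones. Bicycles start at $P_0$, move only when ridden by one rider, and a traveller due to cycle $s_j$ must take a bicycle present at $P_{j-1}$ when he arrives there. $M$ is optimal if it is $k$-uniform for some $k$ and, with $k$ bicycles, the scheme can be executed with no traveller ever having to wait for a bicycle.
   Formalization: The walking and cycling speeds $w$ and $v$ are rational. -}

module Defs where

open import Data.Nat as ℕ using (ℕ; zero; suc; _∸_)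
open import Data.Bool using (Bool; true; false; if_then_else_)
open import Data.Fin using (Fin; toℕ) renaming (zero to fzero; suc to fsuc)
import Data.Fin as Fin
open import Data.Integer using (+_)
open import Data.Rational using (ℚ; _/_; _+_; _*_; _≤_)
open import Data.Product using (Σ; ∃; _×_; _,_)
open import Relation.Nullary using (¬_; does)
open import Relation.Binary.PropositionalEquality using (_≡_)

-- n×n binary matrices: M i j = m_{i+1,j+1} (0-based Fin indices).
Matrix : ℕ → Set
Matrix n = Fin n → Fin n → Bool

b2n : Bool → ℕ
b2n true  = 1
b2n false = 0

S : ∀ {n} → (Fin n → Bool) → ℕ → ℕ
S {zero}  r j       = 0
S {suc n} r zero    = 0
S {suc n} r (suc j) = b2n (r fzero) ℕ.+ S (λ l → r (fsuc l)) j

Uniform : ∀ {n} → Matrix n → ℕ → Set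
Uniform {n} M k = (∀ i → S (M i) n ≡ k) × (∀ j → S (λ i → M i j) n ≡ k)

toℚ : ℕ → ℚ
toℚ m = (+ m) / 1

-- c = time to cycle one stage (= 1/v), d = time to walk one stage (= 1/w).
-- Arrival time of traveller i at post P_p if nobody ever waits.
Arrival : ∀ {n} → ℚ → ℚ → Matrix n → Fin n → ℕ → ℚ
Arrival c d M i p = toℚ (S (M i) p) * c + toℚ (p ∸ S (M i) p) * d

-- Execution with k bicycles (named by Fin k, all at P_0 at time 0) without
-- waiting: β i j p is the bicycle t_i rides on stage j (column j, from post
-- P_{toℕ j} to P_{toℕ j + 1}).
-- * on one stage distinct riders use distinct bicycles (a bicycle taken at
--   P_{toℕ j} leaves that post forever);
-- * for a stage j other than the first, the bicycle must have been brought to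
--   P_{toℕ j} by its rider on the previous stage j' (a bicycle moves only when
--   ridden), who arrives there no later than t_i does.
record Executable {n} (c d : ℚ) (M : Matrix n) (k : ℕ) : Set where
  field
    β      : (i j : Fin n) → M i j ≡ true → Fin k
    inj    : ∀ j i i' (p : M i j ≡ true) (p' : M i' j ≡ true) →
             β i j p ≡ β i' j p' → i ≡ i'
    avail  : ∀ i (j j' : Fin n) → toℕ j ≡ suc (toℕ j') → (p : M i j ≡ true) →
             Σ (Fin n) λ i' → Σ (M i' j' ≡ true) λ p' →
               (β i' j' p' ≡ β i j p) ×
               (Arrival c d M i' (toℕ j) ≤ Arrival c d M i (toℕ j))

Optimal : ∀ {n} → ℚ → ℚ → Matrix n → Set
Optimal c d M = ∃ λ k → Uniform M k × Executable c d M k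

-- An applicable instance of the handover-removal rule: consecutive columns
-- a, b (stages j, j+1 with toℕ b = j), rows i₁, i₂.
record Switch {n} (M : Matrix n) : Set where
  field
    a b    : Fin n
    ab     : toℕ b ≡ suc (toℕ a)
    i₁ i₂  : Fin n
    m₁a    : M i₁ a ≡ true
    m₁b    : M i₁ b ≡ false
    m₂a    : M i₂ a ≡ false
    m₂b    : M i₂ b ≡ true
    sums   : S (M i₁) (toℕ b) ≡ S (M i₂) (toℕ b)

swapTails : ∀ {n} → Matrix n → Fin n → Fin n → ℕ → Matrix n
swapTails M i₁ i₂ t i l =
  if does (toℕ l ℕ.<? t) then M i l
  else if does (i Fin.≟ i₁) then M i₂ l
  else if does (i Fin.≟ i₂) then M i₁ l
  else M i l

apply : ∀ {n} (M : Matrix n) → Switch M → Matrix n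
apply M s = swapTails M (Switch.i₁ s) (Switch.i₂ s) (toℕ (Switch.b s))

data Step {n} (M : Matrix n) : Matrix n → Set where
  step : (s : Switch M) → Step M (apply M s)

{-# OPTIONS --safe #-}
-- So on each stage the riders of
-- the new scheme are those of the old one renamed, by the identity up to stage j and by the
-- transposition (i₁ i₂) afterwards; since S_{i₁,j} = S_{i₂,j}, every renamed traveller reaches
-- both ends of the stage at the same times as the one he replaces.  Hence k-uniformity and a
-- bicycle assignment without waiting carry over.  Termination: the switch removes the dismount
-- of t_{i₁} at P_j and creates no other, so the number of dismounts strictly decreases.
module Submission where

open import Defs

open import Axiom.UniquenessOfIdentityProofs using (module Decidable⇒UIP)
open import Data.Bool using (Bool; true; false; if_then_else_)
import Data.Bool.Properties as Boolₚ
open import Data.Fin using (Fin; toℕ; inject₁; fromℕ) renaming (zero to fzero; suc to fsuc)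
open import Data.Fin.Properties using (toℕ-injective; toℕ-inject₁; toℕ-fromℕ; any?)
  renaming (_≟_ to _≟ᶠ_)
open import Data.Fin.Permutation using (Permutation′; _⟨$⟩ʳ_; _⟨$⟩ˡ_; inverseˡ; inverseʳ; transpose)
  renaming (id to idₚ)
import Data.Fin.Permutation.Components as PC
open import Data.Nat using (ℕ; zero; suc; _+_; _≤_; _<_; z≤n; z<s; s≤s; s≤s⁻¹; _∸_; _<?_)
open import Data.Nat.Properties
open import Algebra.Properties.CommutativeMonoid.Sum +-0-commutativeMonoid
  using (sum; sum-cong-≗; sum-permute)
open import Data.Nat.Induction using (<-wellFounded)
open import Data.Product using (Σ; ∃; _×_; _,_)
import Data.Rational as ℚ
open import Data.Sum using (_⊎_; inj₁; inj₂)
open import Function using (_∘_)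
open import Induction.WellFounded using (Acc; acc)
open import Relation.Binary using (tri<; tri≈; tri>)
open import Relation.Binary.Construct.Closure.ReflexiveTransitive using (Star; ε; _◅_)
open import Relation.Binary.PropositionalEquality
open import Relation.Nullary using (¬_; Dec; yes; no; does; contradiction)
open import Relation.Nullary.Decidable using (map′; _×-dec_; dec-true; dec-false)

sum-mono-≤ : ∀ {n} {f g : Fin n → ℕ} → (∀ i → f i ≤ g i) → sum f ≤ sum g
sum-mono-≤ {zero}  f≤g = z≤n
sum-mono-≤ {suc n} f≤g = +-mono-≤ (f≤g fzero) (sum-mono-≤ (f≤g ∘ fsuc))

sum-mono-< : ∀ {n} {f g : Fin n → ℕ} (i : Fin n) →
             (∀ j → f j ≤ g j) → f i < g i → sum f < sum g
sum-mono-< fzero    f≤g fi<gi = +-mono-<-≤ fi<gi (sum-mono-≤ (f≤g ∘ fsuc))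
sum-mono-< (fsuc i) f≤g fi<gi = +-mono-≤-< (f≤g fzero) (sum-mono-< i (f≤g ∘ fsuc) fi<gi)

transpose-cases : ∀ {n} (i j k : Fin n) →
                  (k ≡ i × PC.transpose i j k ≡ j) ⊎ (k ≡ j × PC.transpose i j k ≡ i) ⊎
                  PC.transpose i j k ≡ k
transpose-cases i j k with k ≟ᶠ i
... | yes k≡i = inj₁ (k≡i , refl)
... | no _ with k ≟ᶠ j
...   | yes k≡j = inj₂ (inj₁ (k≡j , refl))
...   | no _    = inj₂ (inj₂ refl)

transpose-here : ∀ {n} (i j : Fin n) → PC.transpose i j i ≡ j
transpose-here i j with i ≟ᶠ i
... | yes _   = refl
... | no i≢i = contradiction refl i≢i

row-transpose : ∀ {n} (M : Matrix n) (i₁ i₂ i l : Fin n) →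
                (if does (i ≟ᶠ i₁) then M i₂ l else if does (i ≟ᶠ i₂) then M i₁ l else M i l)
                ≡ M (PC.transpose i₁ i₂ i) l
row-transpose M i₁ i₂ i l with does (i ≟ᶠ i₁)
... | true  = refl
... | false with does (i ≟ᶠ i₂)
...   | true  = refl
...   | false = refl

S-total : ∀ {n} (r : Fin n → Bool) → S r n ≡ sum (b2n ∘ r)
S-total {zero}  r = refl
S-total {suc n} r = cong (b2n (r fzero) +_) (S-total (r ∘ fsuc))

S-cong-< : ∀ {n} (r r′ : Fin n → Bool) p → (∀ l → toℕ l < p → r l ≡ r′ l) → S r p ≡ S r′ p
S-cong-< {zero}  r r′ p       r≡r′ = refl
S-cong-< {suc n} r r′ zero    r≡r′ = refl
S-cong-< {suc n} r r′ (suc p) r≡r′ =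
  cong₂ _+_ (cong b2n (r≡r′ fzero z<s))
            (S-cong-< (r ∘ fsuc) (r′ ∘ fsuc) p (λ l l<p → r≡r′ (fsuc l) (s≤s l<p)))

-- The offsets c₁, c₂ make the induction go through when the heads of r₁ and r₂ differ.
S-splice : ∀ {n} (r r₁ r₂ : Fin n → Bool) t p c₁ c₂ →
           (∀ l → toℕ l < t → r l ≡ r₁ l) → (∀ l → t ≤ toℕ l → r l ≡ r₂ l) → t ≤ p →
           c₁ + S r₁ t ≡ c₂ + S r₂ t → c₁ + S r p ≡ c₂ + S r₂ p
S-splice {zero}  r r₁ r₂ t p c₁ c₂ _ _ _ eq = eq
S-splice {suc n} r r₁ r₂ zero p c₁ c₂ _ r≡r₂ _ eq =
  cong₂ _+_ (+-cancelʳ-≡ 0 c₁ c₂ eq) (S-cong-< r r₂ p (λ l _ → r≡r₂ l z≤n))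
S-splice {suc n} r r₁ r₂ (suc t) (suc p) c₁ c₂ r≡r₁ r≡r₂ (s≤s t≤p) eq = begin
  c₁ + (b2n (r fzero) + S (r ∘ fsuc) p)   ≡⟨ cong (λ x → c₁ + (b2n x + _)) (r≡r₁ fzero z<s) ⟩
  c₁ + (b2n (r₁ fzero) + S (r ∘ fsuc) p)  ≡⟨ +-assoc c₁ _ _ ⟨
  c₁ + b2n (r₁ fzero) + S (r ∘ fsuc) p    ≡⟨ tails ⟩
  c₂ + b2n (r₂ fzero) + S (r₂ ∘ fsuc) p   ≡⟨ +-assoc c₂ _ _ ⟩
  c₂ + (b2n (r₂ fzero) + S (r₂ ∘ fsuc) p) ∎
  where
  open ≡-Reasoning
  tails : c₁ + b2n (r₁ fzero) + S (r ∘ fsuc) p ≡ c₂ + b2n (r₂ fzero) + S (r₂ ∘ fsuc) p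
  tails = S-splice (r ∘ fsuc) (r₁ ∘ fsuc) (r₂ ∘ fsuc) t p _ _
            (λ l l<t → r≡r₁ (fsuc l) (s≤s l<t)) (λ l t≤l → r≡r₂ (fsuc l) (s≤s t≤l)) t≤p
            (trans (+-assoc c₁ _ _) (trans eq (sym (+-assoc c₂ _ _))))

Arrival-cong : ∀ {n c d} {M M′ : Matrix n} {i i′ p} →
               S (M i) p ≡ S (M′ i′) p → Arrival c d M i p ≡ Arrival c d M′ i′ p
Arrival-cong {c = c} {d = d} {p = p} eq = cong (λ s → toℚ s ℚ.* c ℚ.+ toℚ (p ∸ s) ℚ.* d) eq

bicycle-cong : ∀ {n c d k} {M : Matrix n} (E : Executable c d M k) {i i′} l → i ≡ i′ →
               (p : M i l ≡ true) (p′ : M i′ l ≡ true) →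
               Executable.β E i l p ≡ Executable.β E i′ l p′
bicycle-cong E l refl p p′ =
  cong (Executable.β E _ l) (Decidable⇒UIP.≡-irrelevant Boolₚ._≟_ p p′)

record Relabelling {n} (M M′ : Matrix n) : Set where
  field
    π       : Fin n → Permutation′ n
    entry   : ∀ i l → M′ i l ≡ M (π l ⟨$⟩ʳ i) l
    departs : ∀ i l → S (M′ i) (toℕ l) ≡ S (M (π l ⟨$⟩ʳ i)) (toℕ l)
    arrives : ∀ i l → S (M′ i) (suc (toℕ l)) ≡ S (M (π l ⟨$⟩ʳ i)) (suc (toℕ l))

last-stage : ∀ {n} → Fin n → Σ (Fin n) λ l → suc (toℕ l) ≡ n
last-stage {suc n} _ = fromℕ n , cong suc (toℕ-fromℕ n)

module _ {n} {M M′ : Matrix n} (R : Relabelling M M′) where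
  open Relabelling R

  relabel-uniform : ∀ {k} → Uniform M k → Uniform M′ k
  relabel-uniform {k} (rows , columns) = rows′ , λ l → trans (column-sum l) (columns l)
    where
    open ≡-Reasoning
    rows′ : ∀ i → S (M′ i) n ≡ k
    rows′ i = let (l , l-last) = last-stage i in begin
      S (M′ i) n                            ≡⟨ cong (S (M′ i)) l-last ⟨
      S (M′ i) (suc (toℕ l))                ≡⟨ arrives i l ⟩
      S (M (π l ⟨$⟩ʳ i)) (suc (toℕ l))      ≡⟨ cong (S (M (π l ⟨$⟩ʳ i))) l-last ⟩
      S (M (π l ⟨$⟩ʳ i)) n                  ≡⟨ rows (π l ⟨$⟩ʳ i) ⟩
      k                                     ∎
    column-sum : ∀ l → S (λ i → M′ i l) n ≡ S (λ i → M i l) n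
    column-sum l = begin
      S (λ i → M′ i l) n                    ≡⟨ S-total (λ i → M′ i l) ⟩
      sum (λ i → b2n (M′ i l))              ≡⟨ sum-cong-≗ (λ i → cong b2n (entry i l)) ⟩
      sum (λ i → b2n (M (π l ⟨$⟩ʳ i) l))    ≡⟨ sum-permute (λ i → b2n (M i l)) (π l) ⟨
      sum (λ i → b2n (M i l))               ≡⟨ S-total (λ i → M i l) ⟨
      S (λ i → M i l) n                     ∎

  relabel-executable : ∀ {c d k} → Executable c d M k → Executable c d M′ k
  relabel-executable {c} {d} {k} E = record { β = β′ ; inj = inj′ ; avail = avail′ }
    where
    open Executable E

    rides : ∀ {i l} → M′ i l ≡ true → M (π l ⟨$⟩ʳ i) l ≡ true
    rides {i} {l} p = trans (sym (entry i l)) p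

    β′ : ∀ i l → M′ i l ≡ true → Fin k
    β′ i l p = β (π l ⟨$⟩ʳ i) l (rides p)

    inj′ : ∀ j i i′ (p : M′ i j ≡ true) (p′ : M′ i′ j ≡ true) → β′ i j p ≡ β′ i′ j p′ → i ≡ i′
    inj′ j i i′ p p′ same = begin
      i                              ≡⟨ inverseˡ (π j) ⟨
      π j ⟨$⟩ˡ (π j ⟨$⟩ʳ i)          ≡⟨ cong (π j ⟨$⟩ˡ_) (inj j _ _ (rides p) (rides p′) same) ⟩
      π j ⟨$⟩ˡ (π j ⟨$⟩ʳ i′)         ≡⟨ inverseˡ (π j) ⟩
      i′                             ∎
      where open ≡-Reasoning

    avail′ : ∀ i (j j′ : Fin n) → toℕ j ≡ suc (toℕ j′) → (p : M′ i j ≡ true) →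
             Σ (Fin n) λ i′ → Σ (M′ i′ j′ ≡ true) λ p′ →
               (β′ i′ j′ p′ ≡ β′ i j p) × (Arrival c d M′ i′ (toℕ j) ℚ.≤ Arrival c d M′ i (toℕ j))
    avail′ i j j′ j≡j′+1 p with avail (π j ⟨$⟩ʳ i) j j′ j≡j′+1 (rides p)
    ... | i″ , q″ , same-bicycle , earlier = π j′ ⟨$⟩ˡ i″ , p′ , same-bicycle′ , earlier′
      where
      back : π j′ ⟨$⟩ʳ (π j′ ⟨$⟩ˡ i″) ≡ i″
      back = inverseʳ (π j′)
      p′ : M′ (π j′ ⟨$⟩ˡ i″) j′ ≡ true
      p′ = trans (entry _ j′) (trans (cong (λ x → M x j′) back) q″)
      same-bicycle′ : β′ (π j′ ⟨$⟩ˡ i″) j′ p′ ≡ β′ i j p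
      same-bicycle′ = trans (bicycle-cong E j′ back (rides p′) q″) same-bicycle
      arrives-j : S (M′ (π j′ ⟨$⟩ˡ i″)) (toℕ j) ≡ S (M i″) (toℕ j)
      arrives-j = subst (λ q → S (M′ _) q ≡ S (M i″) q) (sym j≡j′+1)
                    (trans (arrives _ j′) (cong (λ x → S (M x) (suc (toℕ j′))) back))
      earlier′ : Arrival c d M′ (π j′ ⟨$⟩ˡ i″) (toℕ j) ℚ.≤ Arrival c d M′ i (toℕ j)
      earlier′ = subst₂ ℚ._≤_ (sym arrival″) (sym arrival) earlier
        where
        arrival″ : Arrival c d M′ (π j′ ⟨$⟩ˡ i″) (toℕ j) ≡ Arrival c d M i″ (toℕ j)
        arrival″ = Arrival-cong {M = M′} {M} arrives-j
        arrival : Arrival c d M′ i (toℕ j) ≡ Arrival c d M (π j ⟨$⟩ʳ i) (toℕ j)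
        arrival = Arrival-cong {M = M′} {M} (departs i j)

dismount : Bool → Bool → ℕ
dismount true false = 1
dismount _    _     = 0

dismounts : ∀ {n} → Matrix n → Fin n → Fin n → ℕ
dismounts M l l′ = sum λ i → dismount (M i l) (M i l′)

handovers : ∀ {n} → Matrix n → ℕ
handovers {zero}  M = 0
handovers {suc n} M = sum λ l → dismounts M (inject₁ l) (fsuc l)

dismounts-relabel : ∀ {n} {M M′ : Matrix n} {l l′} (π : Permutation′ n) →
                    (∀ i → M′ i l ≡ M (π ⟨$⟩ʳ i) l) → (∀ i → M′ i l′ ≡ M (π ⟨$⟩ʳ i) l′) →
                    dismounts M′ l l′ ≡ dismounts M l l′
dismounts-relabel {M = M} {l = l} {l′} π at-l at-l′ =
  trans (sum-cong-≗ (λ i → cong₂ dismount (at-l i) (at-l′ i)))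
        (sym (sum-permute (λ i → dismount (M i l) (M i l′)) π))

module Switching {n} {M : Matrix n} (s : Switch M) where
  open Switch s

  t : ℕ
  t = toℕ b

  M′ : Matrix n
  M′ = apply M s

  σ : Permutation′ n
  σ = transpose i₁ i₂

  π : Fin n → Permutation′ n
  π l = if does (toℕ l <? t) then idₚ else σ

  entry : ∀ i l → M′ i l ≡ M (π l ⟨$⟩ʳ i) l
  entry i l with does (toℕ l <? t)
  ... | true  = refl
  ... | false = row-transpose M i₁ i₂ i l

  π-< : ∀ {l} → toℕ l < t → π l ≡ idₚ
  π-< {l} l<t rewrite dec-true (toℕ l <? t) l<t = refl

  π-≥ : ∀ {l} → t ≤ toℕ l → π l ≡ σ
  π-≥ {l} t≤l rewrite dec-false (toℕ l <? t) (≤⇒≯ t≤l) = refl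

  entry-< : ∀ i l → toℕ l < t → M′ i l ≡ M i l
  entry-< i l l<t = trans (entry i l) (cong (λ ρ → M (ρ ⟨$⟩ʳ i) l) (π-< l<t))

  entry-≥ : ∀ i l → t ≤ toℕ l → M′ i l ≡ M (σ ⟨$⟩ʳ i) l
  entry-≥ i l t≤l = trans (entry i l) (cong (λ ρ → M (ρ ⟨$⟩ʳ i) l) (π-≥ t≤l))

  S-before : ∀ i p → p ≤ t → S (M′ i) p ≡ S (M i) p
  S-before i p p≤t = S-cong-< (M′ i) (M i) p (λ l l<p → entry-< i l (<-≤-trans l<p p≤t))

  S-σ-at-t : ∀ i → S (M i) t ≡ S (M (σ ⟨$⟩ʳ i)) t
  S-σ-at-t i with transpose-cases i₁ i₂ i
  ... | inj₁ (refl , σi≡i₂)        = trans sums (cong (λ x → S (M x) t) (sym σi≡i₂))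
  ... | inj₂ (inj₁ (refl , σi≡i₁)) = trans (sym sums) (cong (λ x → S (M x) t) (sym σi≡i₁))
  ... | inj₂ (inj₂ σi≡i)           = cong (λ x → S (M x) t) (sym σi≡i)

  S-after : ∀ i p → t ≤ p → S (M′ i) p ≡ S (M (σ ⟨$⟩ʳ i)) p
  S-after i p t≤p =
    S-splice (M′ i) (M i) (M (σ ⟨$⟩ʳ i)) t p 0 0 (entry-< i) (entry-≥ i) t≤p (S-σ-at-t i)

  S-on-stage : ∀ i l p → toℕ l ≤ p → p ≤ suc (toℕ l) → S (M′ i) p ≡ S (M (π l ⟨$⟩ʳ i)) p
  S-on-stage i l p l≤p p≤l+1 with ≤-<-connex t (toℕ l)
  ... | inj₁ t≤l = trans (S-after i p (≤-trans t≤l l≤p))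
                         (cong (λ ρ → S (M (ρ ⟨$⟩ʳ i)) p) (sym (π-≥ t≤l)))
  ... | inj₂ l<t = trans (S-before i p (≤-trans p≤l+1 l<t))
                         (cong (λ ρ → S (M (ρ ⟨$⟩ʳ i)) p) (sym (π-< l<t)))

  relabelling : Relabelling M M′
  relabelling = record
    { π       = π
    ; entry   = entry
    ; departs = λ i l → S-on-stage i l (toℕ l) ≤-refl (n≤1+n _)
    ; arrives = λ i l → S-on-stage i l (suc (toℕ l)) (n≤1+n _) ≤-refl
    }

  a<t : toℕ a < t
  a<t = ≤-reflexive (sym ab)

  crossing-entry : ∀ i → dismount (M′ i a) (M′ i b) ≡ dismount (M i a) (M (σ ⟨$⟩ʳ i) b)
  crossing-entry i = cong₂ dismount (entry-< i a a<t) (entry-≥ i b ≤-refl)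

  i₁-keeps-riding : dismount (M′ i₁ a) (M′ i₁ b) < dismount (M i₁ a) (M i₁ b)
  i₁-keeps-riding rewrite crossing-entry i₁ | transpose-here i₁ i₂ | m₁a | m₁b | m₂b = z<s

  crossing-≤ : ∀ i → dismount (M′ i a) (M′ i b) ≤ dismount (M i a) (M i b)
  crossing-≤ i with transpose-cases i₁ i₂ i
  ... | inj₁ (refl , _)        = <⇒≤ i₁-keeps-riding
  ... | inj₂ (inj₁ (refl , _)) rewrite entry-< i₂ a a<t | m₂a = z≤n
  ... | inj₂ (inj₂ σi≡i)       rewrite crossing-entry i | σi≡i = ≤-refl

  crossing : ∀ {l l′} → l ≡ a → l′ ≡ b → dismounts M′ l l′ < dismounts M l l′
  crossing refl refl = sum-mono-< i₁ crossing-≤ i₁-keeps-riding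

  dismounts-≤ : ∀ l l′ → toℕ l′ ≡ suc (toℕ l) → dismounts M′ l l′ ≤ dismounts M l l′
  dismounts-≤ l l′ l′≡l+1 with <-cmp (toℕ l′) t
  ... | tri< l′<t _ _ =
    ≤-reflexive (dismounts-relabel {M = M} {M′} idₚ
                  (λ i → entry-< i l (<-trans (≤-reflexive (sym l′≡l+1)) l′<t))
                  (λ i → entry-< i l′ l′<t))
  ... | tri≈ _ l′≡t _ =
    <⇒≤ (crossing (toℕ-injective (suc-injective (trans (sym l′≡l+1) (trans l′≡t ab))))
                  (toℕ-injective l′≡t))
  ... | tri> _ _ t<l′ =
    ≤-reflexive (dismounts-relabel {M = M} {M′} σ
                  (λ i → entry-≥ i l (s≤s⁻¹ (subst (t <_) l′≡l+1 t<l′)))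
                  (λ i → entry-≥ i l′ (<⇒≤ t<l′)))

boundary-of : ∀ {n} (a b : Fin (suc n)) → toℕ b ≡ suc (toℕ a) →
              Σ (Fin n) λ l → inject₁ l ≡ a × fsuc l ≡ b
boundary-of a (fsuc l) ab = l , toℕ-injective (trans (toℕ-inject₁ l) (suc-injective ab)) , refl

switch-decreases-handovers : ∀ {n} {M : Matrix n} (s : Switch M) →
                             handovers (apply M s) < handovers M
switch-decreases-handovers {zero} s with Switch.a s
... | ()
switch-decreases-handovers {suc n} s =
  let (l₀ , l₀≡a , l₀+1≡b) = boundary-of a b ab in
  sum-mono-< l₀ (λ l → dismounts-≤ (inject₁ l) (fsuc l) (cong suc (sym (toℕ-inject₁ l))))
                (crossing l₀≡a l₀+1≡b)
  where
  open Switch s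
  open Switching s

switch-preserves-optimal : ∀ {n c d} {M : Matrix n} (s : Switch M) →
                           Optimal c d M → Optimal c d (apply M s)
switch-preserves-optimal s (k , uniform , executable) =
  k , relabel-uniform relabelling uniform , relabel-executable relabelling executable
  where open Switching s

switch? : ∀ {n} (M : Matrix n) → Dec (Switch M)
switch? {n} M = map′ toSwitch fromSwitch
  (any? λ a → any? λ b → any? λ i₁ → any? λ i₂ →
     toℕ b ≟ suc (toℕ a) ×-dec M i₁ a Boolₚ.≟ true ×-dec M i₁ b Boolₚ.≟ false ×-dec
     M i₂ a Boolₚ.≟ false ×-dec M i₂ b Boolₚ.≟ true ×-dec S (M i₁) (toℕ b) ≟ S (M i₂) (toℕ b))
  where
  Candidate : Set
  Candidate = ∃ λ (a : Fin n) → ∃ λ (b : Fin n) → ∃ λ i₁ → ∃ λ i₂ →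
    toℕ b ≡ suc (toℕ a) × M i₁ a ≡ true × M i₁ b ≡ false ×
    M i₂ a ≡ false × M i₂ b ≡ true × S (M i₁) (toℕ b) ≡ S (M i₂) (toℕ b)
  toSwitch : Candidate → Switch M
  toSwitch (a , b , i₁ , i₂ , ab , m₁a , m₁b , m₂a , m₂b , sums) = record
    { a = a ; b = b ; ab = ab ; i₁ = i₁ ; i₂ = i₂
    ; m₁a = m₁a ; m₁b = m₁b ; m₂a = m₂a ; m₂b = m₂b ; sums = sums }
  fromSwitch : Switch M → Candidate
  fromSwitch s = let open Switch s in a , b , i₁ , i₂ , ab , m₁a , m₁b , m₂a , m₂b , sums

switch-normal-form : ∀ {n} (P : Matrix n → Set) → (∀ {M} (s : Switch M) → P M → P (apply M s)) →
                     ∀ M → P M → ∃ λ M′ → Star Step M M′ × P M′ × ¬ Switch M′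
switch-normal-form P preserves M = go M (<-wellFounded (handovers M))
  where
  go : ∀ M → Acc _<_ (handovers M) → P M → ∃ λ M′ → Star Step M M′ × P M′ × ¬ Switch M′
  go M (acc smaller) pM with switch? M
  ... | no normal = M , ε , pM , normal
  ... | yes s with go (apply M s) (smaller (switch-decreases-handovers s)) (preserves s pM)
  ...   | M′ , steps , pM′ , normal = M′ , step s ◅ steps , pM′ , normal

theorem3p18 : (n : ℕ) (c d : ℚ.ℚ) → ℚ.0ℚ ℚ.< c → c ℚ.< d → (M : Matrix n) →
              Optimal c d M →
              ∃ λ M' → Star Step M M' × Optimal c d M' × ¬ Switch M'
theorem3p18 n c d _ _ = switch-normal-form (Optimal c d) switch-preserves-optimal
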